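{- Let $Q$ be a strategy with complete lists, $w\in W$, and $Q',Q''\in\mathcal{Q}_w$. Let $x_1,\dots,x_p$ and $u_1,\dots,u_q$ be the active sequences of $w$ for $Q'$ and $Q''$, respectively, and let $y_1,\dots,y_s$ and $v_1,\dots,v_t$ be the corresponding increasing active subsequences (with respect to $Q'(w)$ and $Q''(w)$, respectively). Then: (a) $x_1=y_1=u_1=v_1$; (b) for any $l$ with $l< p$ and $l< q$, let $y_1,\dots,y_j$ and $v_1,\dots,v_{j'}$ be the elements of the two increasing active subsequences occurring among the first $l$ positions of the respective active sequences. If $x_i=u_i$ for all $i\le l$, $j=j'$, and $y_k=v_k$ for all $k\le j$, then $x_{l+1}=u_{l+1}$.
   Context: There are $n$ men $M=\{m_1,\dots,m_n\}$ and $n$ women $W$. A strategy assigns to every person a complete strict preference list over the opposite side; $Q(a)$ is the list of $a$. $\mathcal{Q}_w$ is the set of strategies obtained from $Q$ by replacing only $w$'s list by some permutation of $M$. The matching mechanism is the men-proposing Gale–Shapley algorithm (GS-M): a single man proposes to the top woman remaining on his list; a woman accepts if single, otherwise keeps the one she prefers among her current partner and the proposer and rejects the other; a rejected man deletes her from his list; when several men are single the one with smallest index proposes (so the run is deterministic). The active sequence of $w$ for a strategy $Q'$ is the sequence $x_1,x_2,\dots$ of men who propose to $w$, in the order of their proposals, during GS-M on $Q'$. The increasing active subsequence for $Q'(w)$ is the subsequence $y_1=x_1, y_2,\dots$ consisting of those $x_i$ that are preferred in $Q'(w)$ to every earlier $x_k$ ($k<i$), i.e. the proposals that $w$ accepts;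 thus $y_1<y_2<\cdots$ in increasing order of preference in $Q'(w)$. -}

module Defs where

open import Data.Nat using (ℕ; zero; suc)
open import Data.Fin using (Fin)
open import Data.Fin.Properties using (_≟_)
open import Data.List using (List; []; _∷_; map; length; allFin)
open import Data.Nat.ListAction using (sum)
open import Data.Maybe using (Maybe; just; nothing)
open import Data.Bool using (Bool; true; false; if_then_else_; _∧_; _∨_; not)
open import Data.Product using (_×_; _,_; proj₁; proj₂)
open import Relation.Nullary using (does)
open import Data.List.Relation.Binary.Permutation.Propositional using (_↭_)

-- Men and women are both indexed by Fin n (man m_i is the i-th element of Fin n;
-- smaller index = smaller Fin).
-- A strategy: every man has a list over women, every woman a list over men.
record Strategy (n : ℕ) : Set where
  field
    menPref   : Fin n → List (Fin n)
    womenPref : Fin n → List (Fin n)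

open Strategy public

Complete : {n : ℕ} → Strategy n → Set
Complete {n} Q = (∀ m → menPref Q m ↭ allFin n) × (∀ w → womenPref Q w ↭ allFin n)

-- The strategy obtained from Q by replacing only w's list by L  (an element of 𝒬_w
-- when L is a permutation of M).
replaceWoman : {n : ℕ} → Strategy n → Fin n → List (Fin n) → Strategy n
menPref   (replaceWoman Q w L) = menPref Q
womenPref (replaceWoman Q w L) v = if does (v ≟ w) then L else womenPref Q v

prefers : {n : ℕ} → List (Fin n) → Fin n → Fin n → Bool
prefers [] a b = false
prefers (c ∷ L) a b =
  if does (c ≟ a) then not (does (c ≟ b))
  else (if does (c ≟ b) then false else prefers L a b)

-- State of GS-M: each man's remaining list (women he has not yet proposed to),
-- and each woman's current partner.
record State (n : ℕ) : Set where
  field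
    remaining : Fin n → List (Fin n)
    holds     : Fin n → Maybe (Fin n)

open State public

eqMaybe : {n : ℕ} → Maybe (Fin n) → Fin n → Bool
eqMaybe nothing  m = false
eqMaybe (just a) m = does (a ≟ m)

anyL : {A : Set} → (A → Bool) → List A → Bool
anyL p []       = false
anyL p (x ∷ xs) = p x ∨ anyL p xs

isSingle : {n : ℕ} → State n → Fin n → Bool
isSingle {n} s m = not (anyL (λ v → eqMaybe (holds s v) m) (allFin n))

nonEmpty : {A : Set} → List A → Bool
nonEmpty []      = false
nonEmpty (_ ∷ _) = true

firstWhere : {A : Set} → (A → Bool) → List A → Maybe A
firstWhere p []       = nothing
firstWhere p (x ∷ xs) = if p x then just x else firstWhere p xs

respond : {n : ℕ} → List (Fin n) → Fin n → Maybe (Fin n) → Maybe (Fin n)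
respond L m nothing   = just m
respond L m (just m') = if prefers L m m' then just m else just m'

-- One proposal of GS-M: the single man of smallest index proposes to the top
-- woman remaining on his list.  (He removes her from his list at the moment of
-- proposing; he would delete her upon any rejection and never proposes to her
-- again otherwise, so the sequence of proposals is exactly that of GS-M.)
step : {n : ℕ} → Strategy n → State n → Maybe (State n × (Fin n × Fin n))
step {n} Q s with firstWhere (λ m → isSingle s m ∧ nonEmpty (remaining s m)) (allFin n)
... | nothing = nothing
... | just m with remaining s m
...   | [] = nothing
...   | w ∷ rest = just (s' , (m , w))
  where
  s' : State n
  remaining s' m' = if does (m' ≟ m) then rest else remaining s m'
  holds s' v = if does (v ≟ w) then respond (womenPref Q w) m (holds s w) else holds s v

run : {n : ℕ} → Strategy n → ℕ → State n → List (Fin n × Fin n)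
run Q zero    s = []
run Q (suc k) s with step Q s
... | nothing         = []
... | just (s' , p)   = p ∷ run Q k s'

initial : {n : ℕ} → Strategy n → State n
remaining (initial Q) = menPref Q
holds     (initial Q) v = nothing

-- Every step deletes one entry of some man's list, so this fuel suffices for
-- the run to reach termination.
fuel : {n : ℕ} → Strategy n → ℕ
fuel {n} Q = sum (map (λ m → length (menPref Q m)) (allFin n))

proposals : {n : ℕ} → Strategy n → List (Fin n × Fin n)
proposals Q = run Q (fuel Q) (initial Q)

proposersTo : {n : ℕ} → Fin n → List (Fin n × Fin n) → List (Fin n)
proposersTo w [] = []
proposersTo w ((m , v) ∷ ps) = if does (v ≟ w) then m ∷ proposersTo w ps else proposersTo w ps

activeSeq : {n : ℕ} → Strategy n → Fin n → List (Fin n)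
activeSeq Q w = proposersTo w (proposals Q)

incGo : {n : ℕ} → List (Fin n) → Maybe (Fin n) → List (Fin n) → List (Fin n)
incGo L best [] = []
incGo L nothing (x ∷ xs) = x ∷ incGo L (just x) xs
incGo L (just b) (x ∷ xs) = if prefers L x b then x ∷ incGo L (just x) xs else incGo L (just b) xs

-- Increasing subsequence of xs w.r.t. preference list L: the elements preferred
-- (in L) to every earlier element.
increasingSub : {n : ℕ} → List (Fin n) → List (Fin n) → List (Fin n)
increasingSub L xs = incGo L nothing xs

-- Changing w's list does not change the men's lists, and GS-M chooses the next proposal
-- (m , v) from the men's remaining lists and who is engaged to whom only.  Hence the runs
-- for Q′ and Q″ perform the same proposals as long as every woman answers them alike.
-- Women other than w have the same list in both strategies; w, receiving a proposal from
-- a man who never proposed to her before, accepts it iff he enters her increasing active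
-- subsequence, so equal increasing subsequences force equal answers of w.  The runs thus
-- coincide up to the (l+1)-th proposal to w.  For (a) one also needs that w receives a
-- proposal at all: otherwise GS-M stops with every man engaged to a woman other than w,
-- which would inject the n men into n − 1 women.
module Submission where

open import Defs
open import Data.Nat using (ℕ; zero; suc; _≤_; _<_; z≤n; s≤s)
open import Data.Nat.Properties
  using (≤-refl; ≤-trans; n≮0; ≤-pred; <-≤-trans; n<1+n; n≤1+n; m≤m+n; m≤n+m; +-mono-≤; +-mono-<-≤; +-mono-≤-<)
open import Data.Nat.ListAction using (sum)
open import Data.Fin using (Fin; fromℕ<; punchOut)
open import Data.Fin.Properties using (_≟_; punchOut-injective; <⇒notInjective)
open import Data.List using (List; []; _∷_; length; take; drop; head; lookup; map; allFin)
open import Data.List.Properties using (∷-injectiveʳ)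
open import Data.List.Membership.Propositional using (_∈_; _∉_)
open import Data.List.Membership.Propositional.Properties using (∈-allFin; ∈-length)
open import Data.List.Relation.Unary.Any using (here; there)
open import Data.List.Relation.Unary.All as All using (All; []; _∷_)
import Data.List.Relation.Unary.All.Properties as All
open import Data.List.Relation.Unary.Unique.Propositional using (Unique)
open import Data.List.Relation.Unary.AllPairs using ([]; _∷_)
open import Data.List.Relation.Unary.Unique.Propositional.Properties using (allFin⁺; Unique[x∷xs]⇒x∉xs)
open import Data.List.Relation.Binary.Permutation.Propositional using (_↭_; ↭-sym; ↭⇒↭ₛ)
open import Data.List.Relation.Binary.Permutation.Propositional.Properties using (∈-resp-↭)
import Data.List.Relation.Binary.Permutation.Setoid.Properties as PermutationSetoid
open import Data.Maybe using (Maybe; just; nothing; _>>=_)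
import Data.Maybe as Maybe
open import Data.Maybe.Properties using (just-injective)
open import Data.Bool using (Bool; true; false; if_then_else_; _∧_; _∨_; not)
open import Data.Bool.Properties using (∧-identityʳ; ∧-zeroʳ; not-injective)
open import Data.Product using (_×_; ∃; _,_; proj₁; proj₂)
open import Data.Empty using (⊥; ⊥-elim)
open import Function using (_∘_)
open import Function.Definitions using (Injective)
open import Relation.Nullary using (¬_; does; yes; no)
open import Relation.Binary.PropositionalEquality

module _ {A : Set} where

  firstWhere-nothing : ∀ (p : A → Bool) xs → firstWhere p xs ≡ nothing → ∀ {x} → x ∈ xs → p x ≡ false
  firstWhere-nothing p (y ∷ ys) e x∈ with p y in py | x∈
  firstWhere-nothing p (y ∷ ys) () x∈ | true  | _
  ... | false | here refl = py
  ... | false | there x∈ys = firstWhere-nothing p ys e x∈ys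

  firstWhere-just : ∀ (p : A → Bool) xs {x} → firstWhere p xs ≡ just x → p x ≡ true
  firstWhere-just p (y ∷ ys) e with p y in py
  firstWhere-just p (y ∷ ys) refl | true = py
  ... | false = firstWhere-just p ys e

  firstWhere-cong : ∀ {p q : A → Bool} → p ≗ q → ∀ xs → firstWhere p xs ≡ firstWhere q xs
  firstWhere-cong p≗q [] = refl
  firstWhere-cong {q = q} p≗q (x ∷ xs) rewrite p≗q x =
    cong (if q x then just x else_) (firstWhere-cong p≗q xs)

  anyL-cong : ∀ {p q : A → Bool} → p ≗ q → ∀ xs → anyL p xs ≡ anyL q xs
  anyL-cong p≗q [] = refl
  anyL-cong {q = q} p≗q (x ∷ xs) rewrite p≗q x = cong (q x ∨_) (anyL-cong p≗q xs)

  anyL-true : ∀ (p : A → Bool) xs → anyL p xs ≡ true → ∃ λ x → p x ≡ true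
  anyL-true p (x ∷ xs) e with p x in px
  ... | true  = x , px
  ... | false = anyL-true p xs e

  head-drop : ∀ (xs : List A) l (l<∣xs∣ : l < length xs) → head (drop l xs) ≡ just (lookup xs (fromℕ< l<∣xs∣))
  head-drop (x ∷ xs) zero    _           = refl
  head-drop (x ∷ xs) (suc l) (s≤s l<∣xs∣) = head-drop xs l l<∣xs∣

  module _ (f g : A → ℕ) (f≤g : ∀ x → f x ≤ g x) where

    sum-map-mono-≤ : ∀ xs → sum (map f xs) ≤ sum (map g xs)
    sum-map-mono-≤ []       = z≤n
    sum-map-mono-≤ (x ∷ xs) = +-mono-≤ (f≤g x) (sum-map-mono-≤ xs)

    sum-map-mono-< : ∀ {y xs} → f y < g y → y ∈ xs → sum (map f xs) < sum (map g xs)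
    sum-map-mono-< {xs = x ∷ xs} fy<gy (here refl) = +-mono-<-≤ fy<gy (sum-map-mono-≤ xs)
    sum-map-mono-< {xs = x ∷ xs} fy<gy (there y∈) = +-mono-≤-< (f≤g x) (sum-map-mono-< fy<gy y∈)

  ≤-sum-map : ∀ (f : A → ℕ) {y xs} → y ∈ xs → f y ≤ sum (map f xs)
  ≤-sum-map f {xs = x ∷ xs} (here refl) = m≤m+n (f x) _
  ≤-sum-map f {xs = x ∷ xs} (there y∈) = ≤-trans (≤-sum-map f y∈) (m≤n+m _ (f x))

injective-hits : ∀ {n} (w : Fin n) {f : Fin n → Fin n} → Injective _≡_ _≡_ f → ¬ (∀ i → f i ≢ w)
injective-hits {suc n} w {f} f-inj f≢w =
  <⇒notInjective {f = f-w} (n<1+n n) (f-inj ∘ punchOut-injective (f≢w _ ∘ sym) (f≢w _ ∘ sym))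
  where
  f-w : Fin (suc n) → Fin n
  f-w i = punchOut {i = w} {j = f i} (f≢w i ∘ sym)

module _ {n : ℕ} where

  incGo-All : ∀ {P : Fin n → Set} L h {xs} → All P xs → All P (incGo L h xs)
  incGo-All L h [] = []
  incGo-All L nothing (px ∷ pxs) = px ∷ incGo-All L _ pxs
  incGo-All L (just b) {x ∷ _} (px ∷ pxs) with prefers L x b
  ... | true  = px ∷ incGo-All L _ pxs
  ... | false = incGo-All L _ pxs

  head-increasingSub : ∀ L (xs : List (Fin n)) → head (increasingSub L xs) ≡ head xs
  head-increasingSub L []      = refl
  head-increasingSub L (x ∷ _) = refl

  womenPref-replaceWoman-self : ∀ Q (w : Fin n) L → womenPref (replaceWoman Q w L) w ≡ L
  womenPref-replaceWoman-self Q w L with w ≟ w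
  ... | yes _  = refl
  ... | no w≢w = ⊥-elim (w≢w refl)

  womenPref-replaceWoman-other : ∀ Q (w : Fin n) L {v} → v ≢ w → womenPref (replaceWoman Q w L) v ≡ womenPref Q v
  womenPref-replaceWoman-other Q w L {v} v≢w with v ≟ w
  ... | yes v≡w = ⊥-elim (v≢w v≡w)
  ... | no _    = refl

  record _≈_ (s₁ s₂ : State n) : Set where
    field
      remaining≗ : remaining s₁ ≗ remaining s₂
      holds≗     : holds s₁ ≗ holds s₂
  open _≈_

  canPropose : State n → Fin n → Bool
  canPropose s m = isSingle s m ∧ nonEmpty (remaining s m)

  Terminal : State n → Set
  Terminal s = ∀ m → canPropose s m ≡ false

  canPropose-[] : ∀ {s m} → remaining s m ≡ [] → canPropose s m ≢ true
  canPropose-[] {s} {m} rem-m rewrite rem-m | ∧-zeroʳ (isSingle s m) = λ ()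

  record Transition (Q : Strategy n) (m v : Fin n) (s t : State n) : Set where
    field
      remaining-proposer : remaining s m ≡ v ∷ remaining t m
      remaining-other    : ∀ u → u ≢ m → remaining t u ≡ remaining s u
      holds-other        : ∀ u → u ≢ v → holds t u ≡ holds s u
      holds-target       : holds t v ≡ respond (womenPref Q v) m (holds s v)
  open Transition

  StepOutcome : Strategy n → State n → Maybe (State n × (Fin n × Fin n)) → Set
  StepOutcome Q s nothing                 = Terminal s
  StepOutcome Q s (just (t , (m , v))) = Transition Q m v s t

  step-outcome : ∀ Q s → StepOutcome Q s (step Q s)
  step-outcome Q s with firstWhere (canPropose s) (allFin n) in found
  ... | nothing = λ m → firstWhere-nothing _ (allFin n) found (∈-allFin m)
  ... | just m with remaining s m in rem-m
  ...   | [] = ⊥-elim (canPropose-[] {s} {m} rem-m (firstWhere-just _ (allFin n) found))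
  ...   | v ∷ rest = record
    { remaining-proposer = trans rem-m (cong (v ∷_) (sym (if-≟-yes m)))
    ; remaining-other    = λ u → if-≟-no
    ; holds-other        = λ u → if-≟-no
    ; holds-target       = if-≟-yes v
    }
    where
    if-≟-yes : ∀ {B : Set} (a : Fin n) {x y : B} → (if does (a ≟ a) then x else y) ≡ x
    if-≟-yes a with a ≟ a
    ... | yes _  = refl
    ... | no a≢a = ⊥-elim (a≢a refl)
    if-≟-no : ∀ {B : Set} {a b : Fin n} {x y : B} → a ≢ b → (if does (a ≟ b) then x else y) ≡ y
    if-≟-no {a = a} {b} a≢b with a ≟ b
    ... | yes a≡b = ⊥-elim (a≢b a≡b)
    ... | no _    = refl

  nextProposal : State n → Maybe (Fin n × Fin n)
  nextProposal s = firstWhere (canPropose s) (allFin n) >>= λ m → Maybe.map (m ,_) (head (remaining s m))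

  step-nextProposal : ∀ Q s → Maybe.map proj₂ (step Q s) ≡ nextProposal s
  step-nextProposal Q s with firstWhere (canPropose s) (allFin n)
  ... | nothing = refl
  ... | just m with remaining s m
  ...   | []    = refl
  ...   | _ ∷ _ = refl

  canPropose-cong : ∀ {s₁ s₂} → s₁ ≈ s₂ → canPropose s₁ ≗ canPropose s₂
  canPropose-cong s₁≈s₂ m = cong₂ _∧_
    (cong not (anyL-cong (λ v → cong (λ h → eqMaybe h m) (holds≗ s₁≈s₂ v)) (allFin n)))
    (cong nonEmpty (remaining≗ s₁≈s₂ m))

  nextProposal-cong : ∀ {s₁ s₂} → s₁ ≈ s₂ → nextProposal s₁ ≡ nextProposal s₂
  nextProposal-cong {s₁} {s₂} s₁≈s₂
    rewrite firstWhere-cong (canPropose-cong s₁≈s₂) (allFin n)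
    with firstWhere (canPropose s₂) (allFin n)
  ... | nothing = refl
  ... | just m  = cong (Maybe.map (m ,_) ∘ head) (remaining≗ s₁≈s₂ m)

  transition-≈ : ∀ {Q₁ Q₂ m v s₁ s₂ t₁ t₂} → Transition Q₁ m v s₁ t₁ → Transition Q₂ m v s₂ t₂ → s₁ ≈ s₂ →
                 respond (womenPref Q₁ v) m (holds s₁ v) ≡ respond (womenPref Q₂ v) m (holds s₂ v) → t₁ ≈ t₂
  remaining≗ (transition-≈ {m = m} T₁ T₂ s₁≈s₂ _) u with u ≟ m
  ... | yes refl = ∷-injectiveʳ (trans (sym (remaining-proposer T₁))
                                  (trans (remaining≗ s₁≈s₂ u) (remaining-proposer T₂)))
  ... | no u≢m   = trans (remaining-other T₁ u u≢m)
                     (trans (remaining≗ s₁≈s₂ u) (sym (remaining-other T₂ u u≢m)))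
  holds≗ (transition-≈ {v = v} T₁ T₂ s₁≈s₂ same-answer) u with u ≟ v
  ... | yes refl = trans (holds-target T₁) (trans same-answer (sym (holds-target T₂)))
  ... | no u≢v   = trans (holds-other T₁ u u≢v) (trans (holds≗ s₁≈s₂ u) (sym (holds-other T₂ u u≢v)))

  size : State n → ℕ
  size s = sum (map (λ m → length (remaining s m)) (allFin n))

  transition-size : ∀ {Q m v s t} → Transition Q m v s t → size t < size s
  transition-size {m = m} {s = s} {t} T =
    sum-map-mono-< _ _ shorter shorter-m (∈-allFin m)
    where
    shorter : ∀ u → length (remaining t u) ≤ length (remaining s u)
    shorter u with u ≟ m
    ... | yes refl rewrite remaining-proposer T = n≤1+n _
    ... | no u≢m   rewrite remaining-other T u u≢m = ≤-refl
    shorter-m : length (remaining t m) < length (remaining s m)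
    shorter-m rewrite remaining-proposer T = ≤-refl

  remaining-⊆ : ∀ {Q m v s t} → Transition Q m v s t → ∀ u {x} → x ∈ remaining t u → x ∈ remaining s u
  remaining-⊆ {m = m} T u x∈ with u ≟ m
  ... | yes refl = subst (_ ∈_) (sym (remaining-proposer T)) (there x∈)
  ... | no u≢m   = subst (_ ∈_) (remaining-other T u u≢m) x∈

  remaining-⊇ : ∀ {Q m v s t} → Transition Q m v s t → ∀ u {x} → x ≢ v → x ∈ remaining s u → x ∈ remaining t u
  remaining-⊇ {m = m} T u x≢v x∈ with u ≟ m
  ... | no u≢m   = subst (_ ∈_) (sym (remaining-other T u u≢m)) x∈
  ... | yes refl with subst (_ ∈_) (remaining-proposer T) x∈
  ...   | here x≡v  = ⊥-elim (x≢v x≡v)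
  ...   | there x∈′ = x∈′

  Distinct : State n → Set
  Distinct s = ∀ m → Unique (remaining s m)

  transition-Distinct : ∀ {Q m v s t} → Transition Q m v s t → Distinct s → Distinct t
  transition-Distinct {m = m} T distinct u with u ≟ m
  ... | yes refl with subst Unique (remaining-proposer T) (distinct u)
  ...   | _ ∷ unique-tail = unique-tail
  transition-Distinct T distinct u | no u≢m = subst Unique (sym (remaining-other T u u≢m)) (distinct u)

  never-reproposes : ∀ Q k s {m w} → w ∉ remaining s m → All (_≢ m) (proposersTo w (run Q k s))
  never-reproposes Q zero s w∉ = []
  never-reproposes Q (suc k) s {m} {w} w∉ with step Q s | step-outcome Q s
  ... | nothing | _ = []
  ... | just (t , (m′ , v)) | T with v ≟ w
  ... | no _     = never-reproposes Q k t (w∉ ∘ remaining-⊆ T m)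
  ... | yes refl = m′≢m ∷ never-reproposes Q k t (w∉ ∘ remaining-⊆ T m)
    where
    m′≢m : m′ ≢ m
    m′≢m refl = w∉ (subst (w ∈_) (sym (remaining-proposer T)) (here refl))

  transition-never-reproposes : ∀ {Q m w s t} k → Transition Q m w s t → Distinct s →
                                All (_≢ m) (proposersTo w (run Q k t))
  transition-never-reproposes {Q} {m} {s = s} {t} k T distinct =
    never-reproposes Q k t (Unique[x∷xs]⇒x∉xs (subst Unique (remaining-proposer T) (distinct m)))

  eqMaybe-true : ∀ h {m : Fin n} → eqMaybe h m ≡ true → h ≡ just m
  eqMaybe-true (just a) {m} e with a ≟ m
  ... | yes a≡m = cong just a≡m
  eqMaybe-true (just a) () | no _

  engaged-if-not-single : ∀ s m → isSingle s m ≡ false → ∃ λ v → holds s v ≡ just m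
  engaged-if-not-single s m not-single with anyL-true _ (allFin n) (not-injective not-single)
  ... | v , engaged = v , eqMaybe-true (holds s v) engaged

  terminal-with-w-free : ∀ {s w} → Terminal s → holds s w ≡ nothing → (∀ m → w ∈ remaining s m) → ⊥
  terminal-with-w-free {s} {w} terminal w-free w∈ = injective-hits w fiancée-injective fiancée≢w
    where
    engaged : ∀ m → ∃ λ v → holds s v ≡ just m
    engaged m with remaining s m | w∈ m | terminal m
    ... | _ ∷ _ | _ | not-free = engaged-if-not-single s m (trans (sym (∧-identityʳ _)) not-free)
    fiancée : Fin n → Fin n
    fiancée m = proj₁ (engaged m)
    fiancée≢w : ∀ m → fiancée m ≢ w
    fiancée≢w m fiancée≡w with trans (sym (proj₂ (engaged m))) (trans (cong (holds s) fiancée≡w) w-free)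
    ... | ()
    fiancée-injective : Injective _≡_ _≡_ fiancée
    fiancée-injective {i} {j} same =
      just-injective (trans (sym (proj₂ (engaged i))) (trans (cong (holds s) same) (proj₂ (engaged j))))

  -- Fuel cannot run out first: the man with index w still has w on his list, so size s ≥ 1.
  w-receives-proposal : ∀ Q w k s → size s ≤ k → holds s w ≡ nothing → (∀ m → w ∈ remaining s m) →
                        ∃ λ m → head (proposersTo w (run Q k s)) ≡ just m
  w-receives-proposal Q w zero s size≤0 _ w∈ =
    ⊥-elim (n≮0 (<-≤-trans (∈-length (w∈ w))
                  (≤-trans (≤-sum-map (λ m → length (remaining s m)) (∈-allFin w)) size≤0)))
  w-receives-proposal Q w (suc k) s size≤ w-free w∈ with step Q s | step-outcome Q s
  ... | nothing | terminal = ⊥-elim (terminal-with-w-free {s} terminal w-free w∈)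
  ... | just (t , (m , v)) | T with v ≟ w
  ... | yes refl = m , refl
  ... | no v≢w   = w-receives-proposal Q w k t (≤-pred (<-≤-trans (transition-size T) size≤))
                     (trans (holds-other T w (v≢w ∘ sym)) w-free)
                     (λ u → remaining-⊇ T u (v≢w ∘ sym) (w∈ u))

  -- Freshness of x rules out that x is skipped in one increasing subsequence but reappears
  -- at the head of the other.
  incGo-∷-respond : ∀ L₁ L₂ h x {as} → All (_≢ x) as → incGo L₁ h (x ∷ as) ≡ incGo L₂ h (x ∷ as) →
                    respond L₁ x h ≡ respond L₂ x h × incGo L₁ (respond L₁ x h) as ≡ incGo L₂ (respond L₂ x h) as
  incGo-∷-respond L₁ L₂ nothing x fresh same = refl , ∷-injectiveʳ same
  incGo-∷-respond L₁ L₂ (just b) x {as} fresh same with prefers L₁ x b | prefers L₂ x b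
  ... | true  | true  = refl , ∷-injectiveʳ same
  ... | false | false = refl , same
  ... | true  | false = ⊥-elim (All.head (subst (All (_≢ x)) (sym same) (incGo-All L₂ (just b) fresh)) refl)
  ... | false | true  = ⊥-elim (All.head (subst (All (_≢ x)) same (incGo-All L₁ (just b) fresh)) refl)

  module Lockstep (Q : Strategy n) (w : Fin n) (L₁ L₂ : List (Fin n)) where

    Q₁ Q₂ : Strategy n
    Q₁ = replaceWoman Q w L₁
    Q₂ = replaceWoman Q w L₂

    answers-resp-best : ∀ {h₁ h₁′ h₂ h₂′ xs ys} → h₁ ≡ h₁′ → h₂ ≡ h₂′ →
                        incGo L₁ h₁ xs ≡ incGo L₂ h₂ ys → incGo L₁ h₁′ xs ≡ incGo L₂ h₂′ ys
    answers-resp-best refl refl same = same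

    proposal-elsewhere-≈ : ∀ {m v s₁ s₂ t₁ t₂} → v ≢ w → Transition Q₁ m v s₁ t₁ → Transition Q₂ m v s₂ t₂ →
                           s₁ ≈ s₂ → t₁ ≈ t₂
    proposal-elsewhere-≈ {m} {v} {s₁} {s₂} v≢w T₁ T₂ s₁≈s₂ = transition-≈ T₁ T₂ s₁≈s₂ (begin
      respond (womenPref Q₁ v) m (holds s₁ v) ≡⟨ cong₂ (λ L h → respond L m h)
                                                   (womenPref-replaceWoman-other Q w L₁ v≢w) (holds≗ s₁≈s₂ v) ⟩
      respond (womenPref Q v) m (holds s₂ v)  ≡⟨ cong (λ L → respond L m (holds s₂ v))
                                                   (womenPref-replaceWoman-other Q w L₂ v≢w) ⟨
      respond (womenPref Q₂ v) m (holds s₂ v) ∎)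
      where open ≡-Reasoning

    proposal-to-w-≈ : ∀ {m s₁ s₂ t₁ t₂ as} → Transition Q₁ m w s₁ t₁ → Transition Q₂ m w s₂ t₂ → s₁ ≈ s₂ →
                      All (_≢ m) as → incGo L₁ (holds s₁ w) (m ∷ as) ≡ incGo L₂ (holds s₂ w) (m ∷ as) →
                      t₁ ≈ t₂ × incGo L₁ (holds t₁ w) as ≡ incGo L₂ (holds t₂ w) as
    proposal-to-w-≈ {m} {s₁} {s₂} {t₁} {t₂} {as} T₁ T₂ s₁≈s₂ fresh same
      with incGo-∷-respond L₁ L₂ (holds s₁ w) m fresh
             (trans same (cong (λ h → incGo L₂ h (m ∷ as)) (sym (holds≗ s₁≈s₂ w))))
    ... | same-answer , same-rest =
      transition-≈ T₁ T₂ s₁≈s₂ answers , answers-resp-best {xs = as} {ys = as} (sym t₁-w) (sym t₂-w) same-rest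
      where
      t₁-w : holds t₁ w ≡ respond L₁ m (holds s₁ w)
      t₁-w = trans (holds-target T₁) (cong (λ L → respond L m (holds s₁ w)) (womenPref-replaceWoman-self Q w L₁))
      t₂-w : holds t₂ w ≡ respond L₂ m (holds s₁ w)
      t₂-w = trans (holds-target T₂)
               (cong₂ (λ L h → respond L m h) (womenPref-replaceWoman-self Q w L₂) (sym (holds≗ s₁≈s₂ w)))
      answers : respond (womenPref Q₁ w) m (holds s₁ w) ≡ respond (womenPref Q₂ w) m (holds s₂ w)
      answers = trans (sym (holds-target T₁)) (trans (trans t₁-w (trans same-answer (sym t₂-w))) (holds-target T₂))

    -- The second hypothesis says that w's answers so far agree; holds sᵢ w is her partner
    -- before these l proposals, i.e. the best proposer preceding them.
    proposersTo-agree : ∀ k s₁ s₂ → s₁ ≈ s₂ → Distinct s₁ → ∀ l →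
                        let xs = proposersTo w (run Q₁ k s₁)
                            us = proposersTo w (run Q₂ k s₂)
                        in take l xs ≡ take l us →
                           incGo L₁ (holds s₁ w) (take l xs) ≡ incGo L₂ (holds s₂ w) (take l us) →
                           head (drop l xs) ≡ head (drop l us)
    proposersTo-agree zero s₁ s₂ _ _ l _ _ = refl
    proposersTo-agree (suc k) s₁ s₂ s₁≈s₂ distinct l same-prefix same-answers
      with step Q₁ s₁ | step-outcome Q₁ s₁ | step Q₂ s₂ | step-outcome Q₂ s₂
         | trans (step-nextProposal Q₁ s₁) (trans (nextProposal-cong s₁≈s₂) (sym (step-nextProposal Q₂ s₂)))
    ... | nothing | _ | nothing | _ | _ = refl
    ... | just (t₁ , (m , v)) | T₁ | just (t₂ , (.m , .v)) | T₂ | refl with v ≟ w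
    ... | no v≢w = proposersTo-agree k t₁ t₂ (proposal-elsewhere-≈ v≢w T₁ T₂ s₁≈s₂) (transition-Distinct T₁ distinct) l
                     same-prefix
                     (answers-resp-best {xs = take l (proposersTo w (run Q₁ k t₁))}
                                        {ys = take l (proposersTo w (run Q₂ k t₂))}
                       (sym (holds-other T₁ w (v≢w ∘ sym))) (sym (holds-other T₂ w (v≢w ∘ sym)))
                       same-answers)
    ... | yes refl with l
    ...   | zero  = refl
    ...   | suc l′ with proposal-to-w-≈ T₁ T₂ s₁≈s₂ (All.take⁺ l′ (transition-never-reproposes k T₁ distinct))
                          (trans same-answers (cong (incGo L₂ (holds s₂ w) ∘ (m ∷_)) (sym (∷-injectiveʳ same-prefix))))
    ...     | t₁≈t₂ , same-answers′ = proposersTo-agree k t₁ t₂ t₁≈t₂ (transition-Distinct T₁ distinct) l′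
                                        (∷-injectiveʳ same-prefix)
                                        (trans same-answers′ (cong (incGo L₂ (holds t₂ w)) (∷-injectiveʳ same-prefix)))

lemma1 : (n : ℕ) (Q : Strategy n) (w : Fin n) (L′ L″ : List (Fin n)) →
         Complete Q → L′ ↭ allFin n → L″ ↭ allFin n →
         let xs = activeSeq (replaceWoman Q w L′) w
             us = activeSeq (replaceWoman Q w L″) w
             ys = increasingSub L′ xs
             vs = increasingSub L″ us
         in (∃ λ m → head xs ≡ just m × head ys ≡ just m × head us ≡ just m × head vs ≡ just m)
            × ((l : ℕ) (lp : l < length xs) (lq : l < length us) →
               take l xs ≡ take l us →
               increasingSub L′ (take l xs) ≡ increasingSub L″ (take l us) →
               lookup xs (fromℕ< lp) ≡ lookup us (fromℕ< lq))
lemma1 n Q w L′ L″ (men-complete , _) _ _ =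
  (x₁ , x₁-first , trans (head-increasingSub L′ xs) x₁-first , u₁-first , trans (head-increasingSub L″ us) u₁-first) ,
  λ l lp lq same-prefix same-answers → just-injective (begin
    just (lookup xs (fromℕ< lp)) ≡⟨ head-drop xs l lp ⟨
    head (drop l xs)             ≡⟨ agree l same-prefix same-answers ⟩
    head (drop l us)             ≡⟨ head-drop us l lq ⟩
    just (lookup us (fromℕ< lq)) ∎)
  where
  open Lockstep Q w L′ L″
  open ≡-Reasoning

  xs us : List (Fin n)
  xs = activeSeq Q₁ w
  us = activeSeq Q₂ w

  distinct : ∀ m → Unique (menPref Q m)
  distinct m = PermutationSetoid.Unique-resp-↭ (setoid (Fin n)) (↭⇒↭ₛ (↭-sym (men-complete m))) (allFin⁺ n)

  agree : ∀ l → take l xs ≡ take l us → increasingSub L′ (take l xs) ≡ increasingSub L″ (take l us) →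
          head (drop l xs) ≡ head (drop l us)
  agree = proposersTo-agree (fuel Q) (initial Q₁) (initial Q₂)
            (record { remaining≗ = λ _ → refl ; holds≗ = λ _ → refl }) distinct

  first-proposal : ∃ λ x → head xs ≡ just x
  first-proposal = w-receives-proposal Q₁ w (fuel Q) (initial Q₁) ≤-refl refl
                     (λ m → ∈-resp-↭ (↭-sym (men-complete m)) (∈-allFin w))

  x₁ : Fin n
  x₁ = proj₁ first-proposal

  x₁-first : head xs ≡ just x₁
  x₁-first = proj₂ first-proposal

  u₁-first : head us ≡ just x₁
  u₁-first = trans (sym (agree 0 refl refl)) x₁-first
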